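{- Let $n\ge 3$ and let $\sigma$ be a maximal simplex of $\mathcal{VR}(\mathbb{I}_n;2)$. If $v$ is a vertex of $\mathbb{I}_n$ with $|N(v)\cap\sigma|\ge 3$, then either $\sigma=K_v^{i_0,j_0,k_0}$ for some $i_0,j_0,k_0\in[n]$, or $N(v)\subseteq\sigma$.
   Context: $\mathbb{I}_n$ is the graph on $\{0,1\}^n$, two strings adjacent iff they differ in exactly one coordinate; distance is the number of differing coordinates. $\mathcal{VR}(\mathbb{I}_n;r)$ has as simplices the vertex subsets of pairwise distance at most $r$. $[n]=\{1,\dots,n\}$. For a vertex $v$ and distinct indices, $v^{i_1,\dots,i_k}$ is $v$ with coordinates $i_1,\dots,i_k$ flipped; $N(v)=\{v^i:i\in[n]\}$. For distinct $i,j,k\in[n]$, $K_v^{i,j,k}=\{v,v^{i,j},v^{j,k},v^{i,k}\}$. -}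

module Defs where

open import Data.Bool using (Bool; true; false; not; if_then_else_)
open import Data.Nat using (ℕ; zero; suc; _≤_)
open import Data.Fin using (Fin)
open import Data.Vec using (Vec; []; _∷_; updateAt)
open import Data.List using (List; length; filter)
open import Data.List using () renaming (map to lmap)
open import Data.Fin.Base using ()
open import Data.List.Base using ()
open import Data.Sum using (_⊎_)
open import Data.Product using (_×_)
open import Relation.Binary.PropositionalEquality using (_≡_)
open import Relation.Nullary using (¬_)

-- vertices of the hypercube graph 𝕀_n : binary strings of length n
Vertex : ℕ → Set
Vertex n = Vec Bool n

flip : ∀ {n} → Vertex n → Fin n → Vertex n
flip v i = updateAt v i not

flip2 : ∀ {n} → Vertex n → Fin n → Fin n → Vertex n
flip2 v i j = flip (flip v i) j

differ : Bool → Bool → ℕ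
differ true  true  = 0
differ false false = 0
differ true  false = 1
differ false true  = 1

dist : ∀ {n} → Vertex n → Vertex n → ℕ
dist []       []       = 0
dist (a ∷ u)  (b ∷ w)  = differ a b Data.Nat.+ dist u w

VSubset : ℕ → Set
VSubset n = Vertex n → Bool

_∈ₛ_ : ∀ {n} → Vertex n → VSubset n → Set
u ∈ₛ σ = σ u ≡ true

IsSimplex : ∀ {n} → ℕ → VSubset n → Set
IsSimplex {n} r σ =
  (Data.Product.Σ (Vertex n) λ u → u ∈ₛ σ)
  × (∀ u w → u ∈ₛ σ → w ∈ₛ σ → dist u w ≤ r)

IsMaximalSimplex : ∀ {n} → ℕ → VSubset n → Set
IsMaximalSimplex {n} r σ =
  IsSimplex r σ
  × (∀ (τ : VSubset n) → IsSimplex r τ → (∀ u → u ∈ₛ σ → u ∈ₛ τ) → ∀ u → u ∈ₛ τ → u ∈ₛ σ)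

allIdx : (n : ℕ) → List (Fin n)
allIdx n = Data.List.Base.tabulate (λ i → i)

-- |N(v) ∩ σ| : number of i ∈ [n] with v^i ∈ σ  (i ↦ v^i is injective)
neighboursIn : ∀ {n} → Vertex n → VSubset n → ℕ
neighboursIn {n} v σ = length (filter (λ i → Data.Bool.T? (σ (flip v i))) (allIdx n))

InK : ∀ {n} → Vertex n → Fin n → Fin n → Fin n → Vertex n → Set
InK v i j k u = u ≡ v ⊎ (u ≡ flip2 v i j ⊎ (u ≡ flip2 v j k ⊎ u ≡ flip2 v i k))

IsK : ∀ {n} → VSubset n → Vertex n → Fin n → Fin n → Fin n → Set
IsK σ v i j k = ∀ u → (u ∈ₛ σ → InK v i j k u) × (InK v i j k u → u ∈ₛ σ)

Distinct3 : ∀ {n} → Fin n → Fin n → Fin n → Set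
Distinct3 i j k = ¬ i ≡ j × ¬ j ≡ k × ¬ i ≡ k

-- Let v^a, v^b, v^c be three neighbours of v in σ. A vertex u within distance 2 of all
-- three either lies in the closed unit ball around v or equals v^{a,b,c}; if it is also
-- within distance 2 of v^{a,b,c}, it is one of v^a, v^b, v^c, v^{a,b,c}. So if
-- v^{a,b,c} ∈ σ, then σ = K_{v^a}^{a,b,c}. Otherwise σ lies in the unit ball around v,
-- which is itself a simplex, and maximality forces σ to be that ball, so N(v) ⊆ σ.
module Submission where

open import Defs
open import Data.Nat using (ℕ; _≤_)
open import Data.Fin using (Fin)
open import Data.Sum using (_⊎_)
open import Data.Product using (Σ; _×_)

open import Data.Bool using (true; false; not; T?; _≟_)
open import Data.Bool.Properties using (not-involutive; T-≡)
open import Data.Fin using (zero; suc)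
open import Data.List using (List; _∷_; filter; length)
open import Data.List.Membership.Propositional using (_∈_)
open import Data.List.Membership.Propositional.Properties using (∈-filter⁻)
open import Data.List.Relation.Unary.All using (_∷_)
open import Data.List.Relation.Unary.AllPairs using (_∷_)
open import Data.List.Relation.Unary.Any using (here; there)
open import Data.List.Relation.Unary.Unique.Propositional using (Unique)
open import Data.List.Relation.Unary.Unique.Propositional.Properties using (tabulate⁺; filter⁺)
open import Data.Nat using (zero; suc; _+_; _<_; _≤ᵇ_; z≤n; s≤s; s≤s⁻¹)
open import Data.Nat.Properties using (+-commutativeSemigroup; ≤-reflexive; ≤-trans; +-mono-≤; +-suc; n≮0; ≤ᵇ⇒≤; ≤⇒≤ᵇ)
open import Algebra.Properties.CommutativeSemigroup +-commutativeSemigroup using (interchange)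
open import Data.Product using (_,_; proj₁; proj₂)
open import Data.Sum using (inj₁; inj₂)
open import Data.Empty using (⊥; ⊥-elim)
open import Data.Vec using ([]; _∷_; lookup)
open import Data.Vec.Properties using (lookup∘updateAt′; updateAt-updateAt; updateAt-cong; updateAt-id)
open import Function using (id)
open import Function.Bundles using (Equivalence)
open import Relation.Binary.PropositionalEquality using (_≡_; _≢_; refl; sym; trans; cong; cong₂; subst; ≢-sym)
open import Relation.Nullary using (¬_; yes; no)

open Equivalence using (to; from)

flip3 : ∀ {n} → Vertex n → Fin n → Fin n → Fin n → Vertex n
flip3 v i j k = flip (flip2 v i j) k

AgreeAt : ∀ {n} → Vertex n → Vertex n → Fin n → Set
AgreeAt u v i = lookup u i ≡ lookup v i

lookup-flip-≢ : ∀ {n} (v : Vertex n) {i j} → i ≢ j → lookup (flip v i) j ≡ lookup v j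
lookup-flip-≢ v {i} {j} i≢j = lookup∘updateAt′ j i (≢-sym i≢j) v

flip-involutive : ∀ {n} (v : Vertex n) i → flip (flip v i) i ≡ v
flip-involutive v i =
  trans (updateAt-updateAt i v) (trans (updateAt-cong i not-involutive v) (updateAt-id i v))

flip2-cancelˡ : ∀ {n} (v : Vertex n) i j → flip2 (flip v i) i j ≡ flip v j
flip2-cancelˡ v i j = cong (λ w → flip w j) (flip-involutive v i)

differ-self : ∀ a → differ a a ≡ 0
differ-self true  = refl
differ-self false = refl

differ-sym : ∀ a b → differ a b ≡ differ b a
differ-sym true  true  = refl
differ-sym true  false = refl
differ-sym false true  = refl
differ-sym false false = refl

differ-triangle : ∀ a b c → differ a c ≤ differ a b + differ b c
differ-triangle true  true  true  = z≤n
differ-triangle true  true  false = s≤s z≤n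
differ-triangle true  false true  = z≤n
differ-triangle true  false false = s≤s z≤n
differ-triangle false true  true  = s≤s z≤n
differ-triangle false true  false = z≤n
differ-triangle false false true  = s≤s z≤n
differ-triangle false false false = z≤n

differ-not-≡ : ∀ a → differ a (not a) ≡ 1
differ-not-≡ true  = refl
differ-not-≡ false = refl

differ-not-≢ : ∀ a b → a ≢ b → differ a (not b) ≡ 0 × differ a b ≡ 1
differ-not-≢ true  true  a≢b = ⊥-elim (a≢b refl)
differ-not-≢ true  false _   = refl , refl
differ-not-≢ false true  _   = refl , refl
differ-not-≢ false false a≢b = ⊥-elim (a≢b refl)

dist-self : ∀ {n} (u : Vertex n) → dist u u ≡ 0
dist-self []      = refl
dist-self (a ∷ u) = cong₂ _+_ (differ-self a) (dist-self u)

dist-sym : ∀ {n} (u w : Vertex n) → dist u w ≡ dist w u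
dist-sym []      []      = refl
dist-sym (a ∷ u) (b ∷ w) = cong₂ _+_ (differ-sym a b) (dist-sym u w)

dist-triangle : ∀ {n} (u v w : Vertex n) → dist u w ≤ dist u v + dist v w
dist-triangle []      []      []      = z≤n
dist-triangle (a ∷ u) (b ∷ v) (c ∷ w) =
  subst (differ a c + dist u w ≤_) (interchange (differ a b) (differ b c) (dist u v) (dist v w))
    (+-mono-≤ (differ-triangle a b c) (dist-triangle u v w))

dist≤0⇒≡ : ∀ {n} {u w : Vertex n} → dist u w ≤ 0 → u ≡ w
dist≤0⇒≡ {u = []}    {[]}    _ = refl
dist≤0⇒≡ {u = a ∷ u} {b ∷ w} d≤0 with differ a b in ab
dist≤0⇒≡ {u = true  ∷ u} {true  ∷ w} d≤0 | zero = cong (true ∷_) (dist≤0⇒≡ d≤0)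
dist≤0⇒≡ {u = false ∷ u} {false ∷ w} d≤0 | zero = cong (false ∷_) (dist≤0⇒≡ d≤0)
dist≤0⇒≡ {u = true  ∷ u} {false ∷ w} d≤0 | zero with () ← ab
dist≤0⇒≡ {u = false ∷ u} {true  ∷ w} d≤0 | zero with () ← ab

dist-flipʳ-agree : ∀ {n} (u v : Vertex n) i → AgreeAt u v i → dist u (flip v i) ≡ suc (dist u v)
dist-flipʳ-agree (a ∷ u) (b ∷ v) zero    refl rewrite differ-self a | differ-not-≡ a = refl
dist-flipʳ-agree (a ∷ u) (b ∷ v) (suc i) e
  rewrite dist-flipʳ-agree u v i e = +-suc (differ a b) (dist u v)

dist-flipʳ-disagree : ∀ {n} (u v : Vertex n) i → ¬ AgreeAt u v i → suc (dist u (flip v i)) ≡ dist u v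
dist-flipʳ-disagree (a ∷ u) (b ∷ v) zero    a≢b
  rewrite proj₁ (differ-not-≢ a b a≢b) | proj₂ (differ-not-≢ a b a≢b) = refl
dist-flipʳ-disagree (a ∷ u) (b ∷ v) (suc i) d
  rewrite sym (dist-flipʳ-disagree u v i d) = sym (+-suc (differ a b) (dist u (flip v i)))

dist-flip-self : ∀ {n} (v : Vertex n) i → dist (flip v i) v ≡ 1
dist-flip-self v i =
  trans (dist-sym (flip v i) v) (trans (dist-flipʳ-agree v v i refl) (cong suc (dist-self v)))

agreeAt-flip⁺ : ∀ {n} (u v : Vertex n) {i j} → i ≢ j → AgreeAt u v j → AgreeAt u (flip v i) j
agreeAt-flip⁺ u v i≢j a = trans a (sym (lookup-flip-≢ v i≢j))

disagreeAt-flip⁺ : ∀ {n} (u v : Vertex n) {i j} → i ≢ j → ¬ AgreeAt u v j → ¬ AgreeAt u (flip v i) j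
disagreeAt-flip⁺ u v i≢j d a = d (trans a (lookup-flip-≢ v i≢j))

agree-flip-≤ : ∀ {n} (u v : Vertex n) {i r} → AgreeAt u v i → dist u (flip v i) ≤ r → dist u v < r
agree-flip-≤ u v {i} a le = subst (_≤ _) (dist-flipʳ-agree u v i a) le

disagree-flip-≤ : ∀ {n} (u v : Vertex n) {i r} → ¬ AgreeAt u v i → dist u v ≤ suc r → dist u (flip v i) ≤ r
disagree-flip-≤ u v {i} d le = s≤s⁻¹ (subst (_≤ _) (sym (dist-flipʳ-disagree u v i d)) le)

module _ {n} (u v : Vertex n) where

  dist≤1-disagree⇒≡flip : ∀ {i} → dist u v ≤ 1 → ¬ AgreeAt u v i → u ≡ flip v i
  dist≤1-disagree⇒≡flip le d = dist≤0⇒≡ (disagree-flip-≤ u v d le)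

  dist≤1-two-disagreements : ∀ {i j} → i ≢ j → ¬ AgreeAt u v i → ¬ AgreeAt u v j → dist u v ≤ 1 → ⊥
  dist≤1-two-disagreements {j = j} i≢j di dj le =
    disagreeAt-flip⁺ u v i≢j dj (cong (λ w → lookup w j) (dist≤1-disagree⇒≡flip le di))

  three-agreements-far : ∀ {i j k} → Distinct3 i j k →
    AgreeAt u v i → AgreeAt u v j → AgreeAt u v k → dist u (flip3 v i j k) ≤ 2 → ⊥
  three-agreements-far {i} {j} (i≢j , j≢k , i≢k) ai aj ak le =
    n≮0 (agree-flip-≤ u v ai (s≤s⁻¹ (agree-flip-≤ u (flip v i) aj′ (s≤s⁻¹ (agree-flip-≤ u (flip2 v i j) ak′ le)))))
    where
    aj′ = agreeAt-flip⁺ u v i≢j aj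
    ak′ = agreeAt-flip⁺ u (flip v i) j≢k (agreeAt-flip⁺ u v i≢k ak)

  three-disagreements⇒≡flip3 : ∀ {i j k} → Distinct3 i j k →
    ¬ AgreeAt u v i → ¬ AgreeAt u v j → ¬ AgreeAt u v k → dist u (flip v i) ≤ 2 → u ≡ flip3 v i j k
  three-disagreements⇒≡flip3 {i} {j} (i≢j , j≢k , i≢k) _ dj dk le =
    dist≤0⇒≡ (disagree-flip-≤ u (flip2 v i j) dk′ (disagree-flip-≤ u (flip v i) dj′ le))
    where
    dj′ = disagreeAt-flip⁺ u v i≢j dj
    dk′ = disagreeAt-flip⁺ u (flip v i) j≢k (disagreeAt-flip⁺ u v i≢k dk)

  agree-near-flip : ∀ {i} → AgreeAt u v i → dist u (flip v i) ≤ 2 → dist u v ≤ 1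
  agree-near-flip a le = s≤s⁻¹ (agree-flip-≤ u v a le)

  near-three-flips : ∀ {a b c} → Distinct3 a b c →
    dist u (flip v a) ≤ 2 → dist u (flip v b) ≤ 2 → dist u (flip v c) ≤ 2 →
    dist u v ≤ 1 ⊎ u ≡ flip3 v a b c
  near-three-flips {a} {b} {c} abc la lb lc
    with lookup u a ≟ lookup v a | lookup u b ≟ lookup v b | lookup u c ≟ lookup v c
  ... | yes xa | _      | _      = inj₁ (agree-near-flip xa la)
  ... | no _   | yes xb | _      = inj₁ (agree-near-flip xb lb)
  ... | no _   | no _   | yes xc = inj₁ (agree-near-flip xc lc)
  ... | no xa  | no xb  | no xc  = inj₂ (three-disagreements⇒≡flip3 abc xa xb xc la)

  near-four-flips : ∀ {a b c} → Distinct3 a b c →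
    dist u (flip v a) ≤ 2 → dist u (flip v b) ≤ 2 → dist u (flip v c) ≤ 2 → dist u (flip3 v a b c) ≤ 2 →
    InK (flip v a) a b c u
  near-four-flips {a} {b} {c} abc@(a≢b , b≢c , a≢c) la lb lc lk
    with lookup u a ≟ lookup v a | lookup u b ≟ lookup v b | lookup u c ≟ lookup v c
  ... | yes xa | yes xb | yes xc = ⊥-elim (three-agreements-far abc xa xb xc lk)
  ... | yes xa | yes xb | no xc  =
    inj₂ (inj₂ (inj₂ (trans (dist≤1-disagree⇒≡flip (agree-near-flip xa la) xc) (sym (flip2-cancelˡ v a c)))))
  ... | yes xa | no xb  | yes xc =
    inj₂ (inj₁ (trans (dist≤1-disagree⇒≡flip (agree-near-flip xa la) xb) (sym (flip2-cancelˡ v a b))))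
  ... | yes xa | no xb  | no xc  = ⊥-elim (dist≤1-two-disagreements b≢c xb xc (agree-near-flip xa la))
  ... | no xa  | yes xb | yes xc = inj₁ (dist≤1-disagree⇒≡flip (agree-near-flip xb lb) xa)
  ... | no xa  | yes xb | no xc  = ⊥-elim (dist≤1-two-disagreements a≢c xa xc (agree-near-flip xb lb))
  ... | no xa  | no xb  | yes xc = ⊥-elim (dist≤1-two-disagreements a≢b xa xb (agree-near-flip xc lc))
  ... | no xa  | no xb  | no xc  = inj₂ (inj₂ (inj₁ (three-disagreements⇒≡flip3 abc xa xb xc la)))

ball : ∀ {n} → Vertex n → ℕ → VSubset n
ball v r u = dist u v ≤ᵇ r

∈-ball⁺ : ∀ {n} (v u : Vertex n) {r} → dist u v ≤ r → u ∈ₛ ball v r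
∈-ball⁺ v u le = to T-≡ (≤⇒≤ᵇ le)

∈-ball⁻ : ∀ {n} (v u : Vertex n) {r} → u ∈ₛ ball v r → dist u v ≤ r
∈-ball⁻ v u {r} u∈ = ≤ᵇ⇒≤ (dist u v) r (from T-≡ u∈)

ball-isSimplex : ∀ {n} (v : Vertex n) r → IsSimplex (r + r) (ball v r)
ball-isSimplex v r = (v , ∈-ball⁺ v v (subst (_≤ r) (sym (dist-self v)) z≤n)) , diam
  where
  diam : ∀ u w → u ∈ₛ ball v r → w ∈ₛ ball v r → dist u w ≤ r + r
  diam u w u∈ w∈ = ≤-trans (dist-triangle u v w)
    (+-mono-≤ (∈-ball⁻ v u u∈) (subst (_≤ r) (dist-sym w v) (∈-ball⁻ v w w∈)))

three-distinct-members : ∀ {A : Set} (xs : List A) → Unique xs → 3 ≤ length xs →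
  Σ A λ a → Σ A λ b → Σ A λ c → (a ≢ b × b ≢ c × a ≢ c) × (a ∈ xs × b ∈ xs × c ∈ xs)
three-distinct-members (a ∷ b ∷ c ∷ _) ((a≢b ∷ a≢c ∷ _) ∷ (b≢c ∷ _) ∷ _) (s≤s (s≤s (s≤s _))) =
  a , b , c , (a≢b , b≢c , a≢c) , (here refl , there (here refl) , there (there (here refl)))

three-neighbours-in : ∀ {n} (σ : VSubset n) (v : Vertex n) → 3 ≤ neighboursIn v σ →
  Σ (Fin n) λ a → Σ (Fin n) λ b → Σ (Fin n) λ c →
    Distinct3 a b c × (flip v a ∈ₛ σ × flip v b ∈ₛ σ × flip v c ∈ₛ σ)
three-neighbours-in {n} σ v 3≤N =
  let a , b , c , abc , (a∈ , b∈ , c∈) = three-distinct-members _ (filter⁺ P? (tabulate⁺ id)) 3≤N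
  in  a , b , c , abc , (∈σ a∈ , ∈σ b∈ , ∈σ c∈)
  where
  P? = λ (i : Fin n) → T? (σ (flip v i))
  ∈σ : ∀ {i} → i ∈ filter P? (allIdx n) → flip v i ∈ₛ σ
  ∈σ i∈ = to T-≡ (proj₂ (∈-filter⁻ P? {xs = allIdx n} i∈))

module _ {n} {σ : VSubset n} (σ-simplex : IsSimplex 2 σ) {v : Vertex n} {a b c : Fin n}
         (abc : Distinct3 a b c) (σa : flip v a ∈ₛ σ) (σb : flip v b ∈ₛ σ) (σc : flip v c ∈ₛ σ) where

  private
    near : ∀ {u w} → u ∈ₛ σ → w ∈ₛ σ → dist u w ≤ 2
    near = proj₂ σ-simplex _ _

  flip3∈⇒IsK : flip3 v a b c ∈ₛ σ → IsK σ (flip v a) a b c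
  flip3∈⇒IsK σk u = σ⊆K , K⊆σ
    where
    σ⊆K : u ∈ₛ σ → InK (flip v a) a b c u
    σ⊆K u∈ = near-four-flips u v abc (near u∈ σa) (near u∈ σb) (near u∈ σc) (near u∈ σk)
    K⊆σ : InK (flip v a) a b c u → u ∈ₛ σ
    K⊆σ (inj₁ refl)                = σa
    K⊆σ (inj₂ (inj₁ refl))         = subst (_∈ₛ σ) (sym (flip2-cancelˡ v a b)) σb
    K⊆σ (inj₂ (inj₂ (inj₁ refl)))  = σk
    K⊆σ (inj₂ (inj₂ (inj₂ refl)))  = subst (_∈ₛ σ) (sym (flip2-cancelˡ v a c)) σc

  flip3∉⇒⊆ball : ¬ flip3 v a b c ∈ₛ σ → ∀ u → u ∈ₛ σ → u ∈ₛ ball v 1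
  flip3∉⇒⊆ball σk u u∈ with near-three-flips u v abc (near u∈ σa) (near u∈ σb) (near u∈ σc)
  ... | inj₁ le   = ∈-ball⁺ v u le
  ... | inj₂ refl = ⊥-elim (σk u∈)

-- The hypothesis 3 ≤ n is implied by 3 ≤ neighboursIn v σ.
lemma3p2 : (n : ℕ) → 3 ≤ n → (σ : VSubset n) → IsMaximalSimplex 2 σ →
    (v : Vertex n) → 3 ≤ neighboursIn v σ →
    (Σ (Fin n) λ i₀ → Σ (Fin n) λ j₀ → Σ (Fin n) λ k₀ →
       Distinct3 i₀ j₀ k₀ × IsK σ (flip v i₀) i₀ j₀ k₀)
    ⊎ (∀ (i : Fin n) → flip v i ∈ₛ σ)
lemma3p2 n _ σ (σ-simplex , maximal) v 3≤N with three-neighbours-in σ v 3≤N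
... | a , b , c , abc , (σa , σb , σc) with σ (flip3 v a b c) ≟ true
... | yes σk = inj₁ (a , b , c , abc , flip3∈⇒IsK σ-simplex abc σa σb σc σk)
... | no σk  = inj₂ λ i →
  maximal (ball v 1) (ball-isSimplex v 1) (flip3∉⇒⊆ball σ-simplex abc σa σb σc σk)
    (flip v i) (∈-ball⁺ v (flip v i) (≤-reflexive (dist-flip-self v i)))
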